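{- The rotation map $\bullet$ and the orthogonal transpose map $\mathrm{ot}$ commute on the set of LR and opposite LR tableaux: $\mathrm{ot}\,\bullet=\bullet\,\mathrm{ot}$, that is, $(\mathrm{ot}\,\bullet)^2=1$.
   Context: Work in a $d\times(n-d)$ rectangle with alphabet $[d]$. For a word $w=w_1\cdots w_s$ let $w^\bullet=w_s^\bullet\cdots w_1^\bullet$ with $i^\bullet=d-i+1$; for a tableau $T$ of shape $\lambda/\mu$, $\bullet T$ is obtained by rotating $T$ by $\pi$ radians and replacing each entry $i$ by $i^\bullet$, so $w(\bullet T)=w(T)^\bullet$; $\bullet$ exchanges LR tableaux (Yamanouchi word, content $\nu$) and opposite LR tableaux (anti-Yamanouchi word, content $\nu^\bullet$, the reverse of $\nu$). Orthogonal transpose $\mathrm{ot}$: for a Yamanouchi word $w$ of weight $\nu$, $w^{\mathrm{ot}}$ is obtained by replacing, for each $i$, the subword of all letters $i$ (length $\nu_i$) by $12\cdots\nu_i$; for an opposite Yamanouchi word $w$ of weight $\nu^\bullet$, $w^{\mathrm{ot}}$ replaces for each $i$ the subword of letters $d-i+1$ (length $\nu_i$) by $(\nu_1-\nu_i+1)\cdots(\nu_1-1)\nu_1$. For an (opposite) LR tableau $T$ of shape $\lambda/\mu$ with word $w$, $\mathrm{ot}(T)$ is the (opposite) LR tableau of shape $(\lambda/\mu)^{t\bullet}$ (transpose the shape and rotate it by $\pi$) whose column word is $w^{\mathrm{ot}}$. One checks $w^{\bullet\,\mathrm{ot}}=w^{\mathrm{ot}\,\bullet}$ for (opposite) Yamanouchi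 words, so $\mathrm{ot}\,\bullet T$ and $\bullet\,\mathrm{ot}\, T$ have the same column word. -}

module Defs where

open import Data.Nat using (ℕ; zero; suc; _+_; _∸_; _≤_; _<_; _≟_; _≤ᵇ_; _<ᵇ_; _≡ᵇ_)
open import Data.Bool using (Bool; true; false; if_then_else_; _∧_)
open import Data.List using (List; []; _∷_; length; map; reverse; filter; take; drop; concat; concatMap; upTo)
open import Data.Product using (_×_; _,_)
open import Relation.Binary.PropositionalEquality using (_≡_)

-- Conventions
--  * A partition inside an R×C rectangle is a list of R natural numbers
--    (rows top to bottom, padded with zeros).
--  * A skew tableau T of shape λ/μ is given by la (outer), mu (inner) and
--    its rows (top to bottom), each row listed left to right; row r has
--    λ_r - μ_r entries.  Rows and columns are indexed from 0.
--  * Letters are natural numbers; the alphabet [K] is {1,…,K}.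

_!_ : List ℕ → ℕ → ℕ
[] ! _ = 0
(x ∷ xs) ! zero = x
(x ∷ xs) ! suc i = xs ! i

rowAt : List (List ℕ) → ℕ → List ℕ
rowAt [] _ = []
rowAt (x ∷ xs) zero = x
rowAt (x ∷ xs) (suc i) = rowAt xs i

count : ℕ → List ℕ → ℕ
count a xs = length (filter (a ≟_) xs)

record SkewTableau : Set where
  constructor mkT
  field
    outer : List ℕ
    inner : List ℕ
    rows  : List (List ℕ)
open SkewTableau public

InShape : List ℕ → List ℕ → ℕ → ℕ → Set
InShape la mu r c = (mu ! r ≤ c) × (c < la ! r)

entry : SkewTableau → ℕ → ℕ → ℕ
entry T r c = rowAt (rows T) r ! (c ∸ (inner T ! r))

record IsSkewShape (R C : ℕ) (la mu : List ℕ) : Set where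
  field
    lenla   : length la ≡ R
    lenmu   : length mu ≡ R
    decla   : ∀ i → suc i < R → la ! suc i ≤ la ! i
    decmu   : ∀ i → suc i < R → mu ! suc i ≤ mu ! i
    mu⊆la    : ∀ i → i < R → mu ! i ≤ la ! i
    la≤C    : ∀ i → i < R → la ! i ≤ C

record IsTableau (R C K : ℕ) (T : SkewTableau) : Set where
  field
    shape   : IsSkewShape R C (outer T) (inner T)
    lenRows : length (rows T) ≡ R
    lenRow  : ∀ r → r < R → length (rowAt (rows T) r) ≡ (outer T ! r) ∸ (inner T ! r)
    letters : ∀ r c → InShape (outer T) (inner T) r c → (1 ≤ entry T r c) × (entry T r c ≤ K)
    rowWeak : ∀ r c → InShape (outer T) (inner T) r c → InShape (outer T) (inner T) r (suc c)
              → entry T r c ≤ entry T r (suc c)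
    colStrict : ∀ r c → InShape (outer T) (inner T) r c → InShape (outer T) (inner T) (suc r) c
              → entry T r c < entry T (suc r) c

rowWord : SkewTableau → List ℕ
rowWord T = concat (map reverse (rows T))

Yamanouchi : ℕ → List ℕ → Set
Yamanouchi K w = ∀ k i → 1 ≤ i → i < K → count (suc i) (take k w) ≤ count i (take k w)

-- anti-(opposite) Yamanouchi word over [K]: w^• is Yamanouchi, i.e.
-- every suffix has at least as many (i+1)'s as i's
AntiYamanouchi : ℕ → List ℕ → Set
AntiYamanouchi K w = ∀ k i → 1 ≤ i → i < K → count i (drop k w) ≤ count (suc i) (drop k w)

IsLR : ℕ → ℕ → SkewTableau → Set
IsLR d m T = IsTableau d m d T × Yamanouchi d (rowWord T)

IsOppLR : ℕ → ℕ → SkewTableau → Set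
IsOppLR d m T = IsTableau d m d T × AntiYamanouchi d (rowWord T)

-- Rotation •: rotate by π inside a rectangle with C columns and replace
-- each letter a by K - a + 1 (alphabet [K]).

rot : (C K : ℕ) → SkewTableau → SkewTableau
rot C K T = mkT (map (C ∸_) (reverse (inner T)))
                (map (C ∸_) (reverse (outer T)))
                (reverse (map (λ row → reverse (map (λ a → suc K ∸ a) row)) (rows T)))

conj : ℕ → List ℕ → List ℕ
conj C la = map (λ j → length (filter (λ x → suc j Data.Nat.≤? x) la)) (upTo C)

-- outer and inner partitions of (λ/μ)^{t•}, for λ/μ in an R×C rectangle:
-- transpose into the C×R rectangle and rotate by π there
tOuter : (R C : ℕ) → List ℕ → List ℕ → List ℕ
tOuter R C la mu = map (R ∸_) (reverse (conj C mu))

tInner : (R C : ℕ) → List ℕ → List ℕ → List ℕ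
tInner R C la mu = map (R ∸_) (reverse (conj C la))

colCells : ℕ → List ℕ → List ℕ → List (ℕ × ℕ)
colCells C la mu =
  concatMap (λ c → concatMap (λ r → if (mu ! r ≤ᵇ c) ∧ (c <ᵇ la ! r) then (r , c) ∷ [] else [])
                             (upTo (length la)))
            (reverse (upTo C))

colWord : ℕ → SkewTableau → List ℕ
colWord C T = map (λ { (r , c) → entry T r c }) (colCells C (outer T) (inner T))

indexOf : ℕ × ℕ → List (ℕ × ℕ) → ℕ
indexOf p [] = 0
indexOf (r , c) ((r' , c') ∷ ps) = if (r ≡ᵇ r') ∧ (c ≡ᵇ c') then 0 else suc (indexOf (r , c) ps)

fillByColWord : ℕ → List ℕ → List ℕ → List ℕ → List (List ℕ)
fillByColWord C la mu u =
  map (λ r → map (λ c → u ! indexOf (r , c) (colCells C la mu))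
                 (map ((mu ! r) +_) (upTo ((la ! r) ∸ (mu ! r)))))
      (upTo (length la))

-- Yamanouchi word: the k-th occurrence (k ≥ 1) of each letter i becomes k
otYWord : List ℕ → List ℕ
otYWord = go []
  where
  go : List ℕ → List ℕ → List ℕ
  go seen [] = []
  go seen (a ∷ w) = suc (count a seen) ∷ go (a ∷ seen) w

-- opposite Yamanouchi word over [d] of weight ν^•: letter a = d - i + 1
-- occurs ν_i = count a w times; its k-th occurrence becomes ν₁ - ν_i + k,
-- where ν₁ = count d w
otOppWord : ℕ → List ℕ → List ℕ
otOppWord d w = go [] w
  where
  go : List ℕ → List ℕ → List ℕ
  go seen [] = []
  go seen (a ∷ v) = ((count d w ∸ count a w) + suc (count a seen)) ∷ go (a ∷ seen) v

otLR : (d m : ℕ) → SkewTableau → SkewTableau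
otLR d m T = mkT la' mu' (fillByColWord d la' mu' (otYWord (rowWord T)))
  where
  la' = tOuter d m (outer T) (inner T)
  mu' = tInner d m (outer T) (inner T)

otOpp : (d m : ℕ) → SkewTableau → SkewTableau
otOpp d m T = mkT la' mu' (fillByColWord d la' mu' (otOppWord d (rowWord T)))
  where
  la' = tOuter d m (outer T) (inner T)
  mu' = tInner d m (outer T) (inner T)

-- ν₁ (the largest part of the content ν) of an LR / opposite LR tableau
nu1LR : SkewTableau → ℕ
nu1LR T = count 1 (rowWord T)

nu1Opp : ℕ → SkewTableau → ℕ
nu1Opp d T = count d (rowWord T)

-- Rotation reverses the row word and complements its letters; on shapes it
-- commutes with conjugation, and it reverses the column reading order (the
-- cells of the rotated shape, in column order, are the rotated cells of λ/μ
-- read backwards).  So ot • T and • ot T are fillings of the same shape, and it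
-- is enough to compare their column words, i.e. to show (w^•)^ot = (w^ot)^•.
-- If w is Yamanouchi of content ν, the k-th letter a^• of w^• is the
-- (ν_a − k + 1)-th letter a of w; it is labelled ν₁ − ν_a + k in (w^•)^ot and
-- ν_a − k + 1 in w^ot, and these are exchanged by complementation in [ν₁].
-- Yamanouchi gives ν_a ≤ ν₁, so the truncated subtractions are exact; the
-- opposite case is symmetric, with d the most frequent letter.  Finally, a filling
-- is read off its column word by position, so w must have exactly as many
-- letters as (λ/μ)^{t•} has cells: count the cells of λ/μ by rows and by
-- columns.

module Submission where

open import Defs
open import Data.Nat using (ℕ; _≤_; _∸_)
open import Data.Product using (_×_)
open import Relation.Binary.PropositionalEquality using (_≡_)

open import Data.Bool using (true; false; T; _∧_; if_then_else_)
open import Data.Bool.Properties using (∧-comm; ∧-zeroʳ; T-≡)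
open import Function.Bundles using (Equivalence)
open import Data.List using (List; []; _∷_; [_]; _++_; _∷ʳ_; length; map; reverse; filter; concat; upTo; applyUpTo)
open import Data.List.Properties
open import Data.List.Membership.Propositional using (_∈_; _∉_)
open import Data.List.Relation.Unary.All as All using (All; []; _∷_)
open import Data.List.Relation.Unary.All.Properties as All using ()
open import Data.List.Relation.Unary.Any using (here; there)
import Data.List.Relation.Unary.Any.Properties as Any
open import Data.List.Relation.Unary.AllPairs using ([]; _∷_)
import Data.List.Relation.Unary.AllPairs.Properties as AllPairs
open import Data.List.Relation.Unary.Unique.Propositional using (Unique)
import Data.List.Relation.Unary.Unique.Propositional.Properties as Unique
open import Data.Nat using (zero; suc; _+_; _<_; _≤ᵇ_; _<ᵇ_; _≡ᵇ_; z≤n; s≤s)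
open import Data.Nat.Properties
open import Algebra.Properties.CommutativeSemigroup +-commutativeSemigroup using (interchange; xy∙z≈y∙xz)
open import Data.Product using (_,_; proj₁; proj₂)
import Data.Product.Properties as Product
open import Data.Sum using (inj₁; inj₂)
open import Data.Empty using (⊥-elim)
open import Function using (_∘_)
open import Relation.Nullary using (Dec; yes; no; ¬_)
open import Relation.Unary using (Decidable)
open import Relation.Binary.PropositionalEquality
  using (_≢_; refl; sym; trans; cong; cong₂; subst; subst₂; module ≡-Reasoning)
open import Relation.Binary.Definitions using (tri<; tri≈; tri>)

open ≡-Reasoning

module _ {A : Set} {P : A → Set} (P? : Decidable P) where

  length-filter-++ : ∀ xs ys → length (filter P? (xs ++ ys)) ≡ length (filter P? xs) + length (filter P? ys)
  length-filter-++ xs ys = trans (cong length (filter-++ P? xs ys)) (length-++ (filter P? xs))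

  length-filter-reverse : ∀ xs → length (filter P? (reverse xs)) ≡ length (filter P? xs)
  length-filter-reverse [] = refl
  length-filter-reverse (x ∷ xs) = begin
    #P (reverse (x ∷ xs))      ≡⟨ cong #P (unfold-reverse x xs) ⟩
    #P (reverse xs ++ [ x ])   ≡⟨ length-filter-++ (reverse xs) [ x ] ⟩
    #P (reverse xs) + #P [ x ] ≡⟨ cong (_+ #P [ x ]) (length-filter-reverse xs) ⟩
    #P xs + #P [ x ]           ≡⟨ +-comm (#P xs) (#P [ x ]) ⟩
    #P [ x ] + #P xs           ≡⟨ length-filter-++ [ x ] xs ⟨
    #P (x ∷ xs)                ∎
    where
    #P : List A → ℕ
    #P = length ∘ filter P?

count-here : ∀ a xs → count a (a ∷ xs) ≡ suc (count a xs)
count-here a xs = cong length (filter-accept (a ≟_) refl)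

count-there : ∀ {a x} xs → a ≢ x → count a (x ∷ xs) ≡ count a xs
count-there {a} xs a≢x = cong length (filter-reject (a ≟_) a≢x)

count-++ : ∀ a xs ys → count a (xs ++ ys) ≡ count a xs + count a ys
count-++ a = length-filter-++ (a ≟_)

count-reverse : ∀ a xs → count a (reverse xs) ≡ count a xs
count-reverse a = length-filter-reverse (a ≟_)

count-map : ∀ (f : ℕ → ℕ) a xs → All (λ x → f x ≡ f a → x ≡ a) xs → count (f a) (map f xs) ≡ count a xs
count-map f a [] [] = refl
count-map f a (x ∷ xs) (fx≡fa⇒x≡a ∷ rest) with a ≟ x
... | yes refl = begin
  count (f a) (f a ∷ map f xs) ≡⟨ count-here (f a) (map f xs) ⟩
  suc (count (f a) (map f xs)) ≡⟨ cong suc (count-map f a xs rest) ⟩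
  suc (count a xs)             ≡⟨ count-here a xs ⟨
  count a (a ∷ xs)             ∎
... | no a≢x = begin
  count (f a) (f x ∷ map f xs) ≡⟨ count-there (map f xs) (λ fa≡fx → a≢x (sym (fx≡fa⇒x≡a (sym fa≡fx)))) ⟩
  count (f a) (map f xs)       ≡⟨ count-map f a xs rest ⟩
  count a xs                   ≡⟨ count-there xs a≢x ⟨
  count a (x ∷ xs)             ∎

InAlphabet : ℕ → ℕ → Set
InAlphabet K a = 1 ≤ a × a ≤ K

rotLetter : ℕ → ℕ → ℕ
rotLetter K a = suc K ∸ a

rotWord : ℕ → List ℕ → List ℕ
rotWord K w = reverse (map (rotLetter K) w)

rotLetter-injective : ∀ {K a b} → a ≤ K → b ≤ K → rotLetter K a ≡ rotLetter K b → a ≡ b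
rotLetter-injective a≤K b≤K = ∸-cancelˡ-≡ (m≤n⇒m≤1+n a≤K) (m≤n⇒m≤1+n b≤K)

rotLetter-involutive : ∀ {K a} → a ≤ suc K → rotLetter K (rotLetter K a) ≡ a
rotLetter-involutive = m∸[m∸n]≡n

rotWord-∷ : ∀ K a w → rotWord K (a ∷ w) ≡ rotWord K w ∷ʳ rotLetter K a
rotWord-∷ K a w = unfold-reverse (rotLetter K a) (map (rotLetter K) w)

count-rotWord : ∀ {K a} w → a ≤ K → All (_≤ K) w → count (rotLetter K a) (rotWord K w) ≡ count a w
count-rotWord {K} {a} w a≤K w≤K = begin
  count (rotLetter K a) (reverse (map (rotLetter K) w)) ≡⟨ count-reverse _ (map (rotLetter K) w) ⟩
  count (rotLetter K a) (map (rotLetter K) w)           ≡⟨ count-map (rotLetter K) a w (All.map (λ x≤K → rotLetter-injective x≤K a≤K) w≤K) ⟩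
  count a w                                             ∎

reverse-concat : ∀ {A : Set} (xss : List (List A)) → reverse (concat xss) ≡ concat (map reverse (reverse xss))
reverse-concat [] = refl
reverse-concat (xs ∷ xss) = begin
  reverse (xs ++ concat xss)                                   ≡⟨ reverse-++ xs (concat xss) ⟩
  reverse (concat xss) ++ reverse xs                           ≡⟨ cong₂ _++_ (reverse-concat xss) (sym (++-identityʳ (reverse xs))) ⟩
  concat (map reverse (reverse xss)) ++ concat [ reverse xs ]  ≡⟨ concat-++ (map reverse (reverse xss)) [ reverse xs ] ⟩
  concat (map reverse (reverse xss) ++ [ reverse xs ])         ≡⟨ cong concat (map-++ reverse (reverse xss) [ xs ]) ⟨
  concat (map reverse (reverse xss ∷ʳ xs))                     ≡⟨ cong (concat ∘ map reverse) (unfold-reverse xs xss) ⟨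
  concat (map reverse (reverse (xs ∷ xss)))                    ∎

rowWord-rot : ∀ C K T → rowWord (rot C K T) ≡ rotWord K (rowWord T)
rowWord-rot C K (mkT la mu rs) = sym (begin
  reverse (map (rotLetter K) (concat (map reverse rs)))               ≡⟨ cong reverse (concat-map (map reverse rs)) ⟨
  reverse (concat (map (map (rotLetter K)) (map reverse rs)))         ≡⟨ reverse-concat (map (map (rotLetter K)) (map reverse rs)) ⟩
  concat (map reverse (reverse (map (map (rotLetter K)) (map reverse rs))))
    ≡⟨ cong (concat ∘ map reverse ∘ reverse) (trans (sym (map-∘ rs)) (map-cong (reverse-map (rotLetter K)) rs)) ⟩
  concat (map reverse (reverse (map (reverse ∘ map (rotLetter K)) rs))) ∎)

labelOccurrences : (ℕ → ℕ → ℕ) → List ℕ → List ℕ → List ℕ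
labelOccurrences f seen [] = []
labelOccurrences f seen (a ∷ w) = f a (count a seen) ∷ labelOccurrences f (a ∷ seen) w

length-labelOccurrences : ∀ f seen w → length (labelOccurrences f seen w) ≡ length w
length-labelOccurrences f seen [] = refl
length-labelOccurrences f seen (a ∷ w) = cong suc (length-labelOccurrences f (a ∷ seen) w)

labelOccurrences-++ : ∀ f seen xs ys →
  labelOccurrences f seen (xs ++ ys) ≡ labelOccurrences f seen xs ++ labelOccurrences f (reverse xs ++ seen) ys
labelOccurrences-++ f seen [] ys = refl
labelOccurrences-++ f seen (x ∷ xs) ys = cong (f x (count x seen) ∷_) (begin
  labelOccurrences f (x ∷ seen) (xs ++ ys)
    ≡⟨ labelOccurrences-++ f (x ∷ seen) xs ys ⟩
  labelOccurrences f (x ∷ seen) xs ++ labelOccurrences f (reverse xs ++ x ∷ seen) ys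
    ≡⟨ cong (λ s → labelOccurrences f (x ∷ seen) xs ++ labelOccurrences f s ys) reverse-∷-++ ⟨
  labelOccurrences f (x ∷ seen) xs ++ labelOccurrences f (reverse (x ∷ xs) ++ seen) ys ∎)
  where
  reverse-∷-++ : reverse (x ∷ xs) ++ seen ≡ reverse xs ++ x ∷ seen
  reverse-∷-++ = trans (cong (_++ seen) (unfold-reverse x xs)) (++-assoc (reverse xs) [ x ] seen)

-- `otYWord` and `otOppWord` run local helpers that cannot be named from
-- here; each meta below is solved to such a helper by the equation after it.
mutual
  otYWord-go : List ℕ → List ℕ → List ℕ
  otYWord-go = _

  otYWord-∷ : ∀ a v → otYWord (a ∷ v) ≡ 1 ∷ otYWord-go [ a ] v
  otYWord-∷ a v with [ a ]
  ... | s = refl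

mutual
  otOppWord-go : ℕ → List ℕ → List ℕ → List ℕ → List ℕ
  otOppWord-go = _

  otOppWord-∷ : ∀ d a v →
    otOppWord d (a ∷ v) ≡ (count d (a ∷ v) ∸ count a (a ∷ v)) + 1 ∷ otOppWord-go d (a ∷ v) [ a ] v
  otOppWord-∷ d a v with [ a ] | a ∷ v
  ... | s | w = refl

otYLabel : ℕ → ℕ → ℕ
otYLabel _ k = suc k

otOppLabel : ℕ → List ℕ → ℕ → ℕ → ℕ
otOppLabel d w a k = (count d w ∸ count a w) + suc k

otYWord≡labelOccurrences : ∀ w → otYWord w ≡ labelOccurrences otYLabel [] w
otYWord≡labelOccurrences [] = refl
otYWord≡labelOccurrences (a ∷ v) = trans (otYWord-∷ a v) (cong (1 ∷_) (go [ a ] v))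
  where
  go : ∀ seen u → otYWord-go seen u ≡ labelOccurrences otYLabel seen u
  go seen [] = refl
  go seen (b ∷ u) = cong (suc (count b seen) ∷_) (go (b ∷ seen) u)

otOppWord≡labelOccurrences : ∀ d w → otOppWord d w ≡ labelOccurrences (otOppLabel d w) [] w
otOppWord≡labelOccurrences d [] = refl
otOppWord≡labelOccurrences d (a ∷ v) = trans (otOppWord-∷ d a v) (cong (otOppLabel d (a ∷ v) a 0 ∷_) (go [ a ] v))
  where
  go : ∀ seen u → otOppWord-go d (a ∷ v) seen u ≡ labelOccurrences (otOppLabel d (a ∷ v)) seen u
  go seen [] = refl
  go seen (b ∷ u) = cong (otOppLabel d (a ∷ v) b (count b seen) ∷_) (go (b ∷ seen) u)

-- In w the occurrence of a preceded by y and followed by x further a's is,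
-- in rotWord K w, the occurrence of rotLetter K a preceded by x of them.
labelOccurrences-rotWord : ∀ {K L} (f g : ℕ → ℕ → ℕ) w → All (InAlphabet K) w →
  (∀ a x y → InAlphabet K a → x + suc y ≡ count a w → f (rotLetter K a) x ≡ rotLetter L (g a y)) →
  labelOccurrences f [] (rotWord K w) ≡ rotWord L (labelOccurrences g [] w)
labelOccurrences-rotWord {K} {L} f g w w∈[K] label-rot = suffix [] w w∈[K] (λ _ → refl)
  where
  suffix : ∀ seen q → All (InAlphabet K) q → (∀ b → count b seen + count b q ≡ count b w) →
    labelOccurrences f [] (rotWord K q) ≡ rotWord L (labelOccurrences g seen q)
  suffix seen [] _ _ = refl
  suffix seen (a ∷ q) (a∈[K] ∷ q∈[K]) counts = begin
    labelOccurrences f [] (rotWord K (a ∷ q))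
      ≡⟨ cong (labelOccurrences f []) (rotWord-∷ K a q) ⟩
    labelOccurrences f [] (rotWord K q ++ [ rotLetter K a ])
      ≡⟨ labelOccurrences-++ f [] (rotWord K q) [ rotLetter K a ] ⟩
    labelOccurrences f [] (rotWord K q) ++ [ f (rotLetter K a) (count (rotLetter K a) (reverse (rotWord K q) ++ [])) ]
      ≡⟨ cong₂ (λ u z → u ++ [ z ]) (suffix (a ∷ seen) q q∈[K] counts′) last ⟩
    rotWord L (labelOccurrences g (a ∷ seen) q) ∷ʳ rotLetter L (g a (count a seen))
      ≡⟨ rotWord-∷ L (g a (count a seen)) (labelOccurrences g (a ∷ seen) q) ⟨
    rotWord L (labelOccurrences g seen (a ∷ q)) ∎
    where
    counts′ : ∀ b → count b (a ∷ seen) + count b q ≡ count b w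
    counts′ b = begin
      count b (a ∷ seen) + count b q             ≡⟨ cong (_+ count b q) (count-++ b [ a ] seen) ⟩
      (count b [ a ] + count b seen) + count b q ≡⟨ xy∙z≈y∙xz (count b [ a ]) (count b seen) (count b q) ⟩
      count b seen + (count b [ a ] + count b q) ≡⟨ cong (count b seen +_) (count-++ b [ a ] q) ⟨
      count b seen + count b (a ∷ q)             ≡⟨ counts b ⟩
      count b w                                  ∎
    later+suc-earlier : count a q + suc (count a seen) ≡ count a w
    later+suc-earlier = begin
      count a q + suc (count a seen) ≡⟨ +-comm (count a q) (suc (count a seen)) ⟩
      suc (count a seen + count a q) ≡⟨ +-suc (count a seen) (count a q) ⟨
      count a seen + suc (count a q) ≡⟨ cong (count a seen +_) (count-here a q) ⟨
      count a seen + count a (a ∷ q) ≡⟨ counts a ⟩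
      count a w                      ∎
    last : f (rotLetter K a) (count (rotLetter K a) (reverse (rotWord K q) ++ [])) ≡ rotLetter L (g a (count a seen))
    last = begin
      f (rotLetter K a) (count (rotLetter K a) (reverse (rotWord K q) ++ []))
        ≡⟨ cong (f (rotLetter K a) ∘ count (rotLetter K a)) (++-identityʳ (reverse (rotWord K q))) ⟩
      f (rotLetter K a) (count (rotLetter K a) (reverse (rotWord K q)))
        ≡⟨ cong (f (rotLetter K a)) (trans (count-reverse _ (rotWord K q)) (count-rotWord q (proj₂ a∈[K]) (All.map proj₂ q∈[K]))) ⟩
      f (rotLetter K a) (count a q)
        ≡⟨ label-rot a (count a q) (count a seen) a∈[K] later+suc-earlier ⟩
      rotLetter L (g a (count a seen)) ∎

yamanouchi-count≤count1 : ∀ {K w} → Yamanouchi K w → ∀ a → InAlphabet K a → count a w ≤ count 1 w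
yamanouchi-count≤count1 Y (suc zero) _ = ≤-refl
yamanouchi-count≤count1 {w = w} Y (suc (suc i)) (_ , i+2≤K) = ≤-trans
  (subst (λ v → count (suc (suc i)) v ≤ count (suc i) v) (take-all (length w) w ≤-refl) (Y (length w) (suc i) (s≤s z≤n) i+2≤K))
  (yamanouchi-count≤count1 Y (suc i) (s≤s z≤n , <⇒≤ i+2≤K))

antiYamanouchi-count≤countK : ∀ {K w} → AntiYamanouchi K w → ∀ a → InAlphabet K a → count a w ≤ count K w
antiYamanouchi-count≤countK {K} {w} A a (1≤a , a≤K) = climb K ≤-refl a≤K
  where
  climb : ∀ b → b ≤ K → a ≤ b → count a w ≤ count b w
  climb b b≤K a≤b with m≤n⇒m<n∨m≡n a≤b
  ... | inj₂ refl = ≤-refl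
  climb (suc b) b<K _ | inj₁ (s≤s a≤b) = ≤-trans (climb b (<⇒≤ b<K) a≤b) (A 0 b (≤-trans 1≤a a≤b) b<K)

occurrence-complement : ∀ {K ν x y} → ν ≤ K → x + suc y ≡ ν → (K ∸ ν) + suc x ≡ rotLetter K (suc y)
occurrence-complement {K} {ν} {x} {y} ν≤K x+1+y≡ν = begin
  (K ∸ ν) + suc x       ≡⟨ cong ((K ∸ ν) +_) ν∸y≡1+x ⟨
  (K ∸ ν) + (ν ∸ y)     ≡⟨ +-∸-assoc (K ∸ ν) y≤ν ⟨
  ((K ∸ ν) + ν) ∸ y     ≡⟨ cong (_∸ y) (m∸n+n≡m ν≤K) ⟩
  K ∸ y                 ∎
  where
  y≤ν : y ≤ ν
  y≤ν = subst (y ≤_) x+1+y≡ν (≤-trans (n≤1+n y) (m≤n+m (suc y) x))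
  ν∸y≡1+x : ν ∸ y ≡ suc x
  ν∸y≡1+x = begin
    ν ∸ y             ≡⟨ cong (_∸ y) x+1+y≡ν ⟨
    (x + suc y) ∸ y   ≡⟨ cong (_∸ y) (+-suc x y) ⟩
    suc (x + y) ∸ y   ≡⟨ m+n∸n≡m (suc x) y ⟩
    suc x             ∎

otOppWord-rotWord : ∀ d w → All (InAlphabet d) w → Yamanouchi d w →
  otOppWord d (rotWord d w) ≡ rotWord (count 1 w) (otYWord w)
otOppWord-rotWord d w w∈[d] Y = begin
  otOppWord d (rotWord d w)                                        ≡⟨ otOppWord≡labelOccurrences d (rotWord d w) ⟩
  labelOccurrences (otOppLabel d (rotWord d w)) [] (rotWord d w)   ≡⟨ labelOccurrences-rotWord _ otYLabel w w∈[d] label-rot ⟩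
  rotWord (count 1 w) (labelOccurrences otYLabel [] w)             ≡⟨ cong (rotWord (count 1 w)) (otYWord≡labelOccurrences w) ⟨
  rotWord (count 1 w) (otYWord w)                                  ∎
  where
  label-rot : ∀ a x y → InAlphabet d a → x + suc y ≡ count a w →
    otOppLabel d (rotWord d w) (rotLetter d a) x ≡ rotLetter (count 1 w) (suc y)
  label-rot a x y a∈[d]@(1≤a , a≤d) x+1+y≡ν = begin
    (count d (rotWord d w) ∸ count (rotLetter d a) (rotWord d w)) + suc x
      ≡⟨ cong₂ (λ m n → (m ∸ n) + suc x) (count-rotWord w (≤-trans 1≤a a≤d) w≤d) (count-rotWord w a≤d w≤d) ⟩
    (count 1 w ∸ count a w) + suc x
      ≡⟨ occurrence-complement (yamanouchi-count≤count1 Y a a∈[d]) x+1+y≡ν ⟩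
    rotLetter (count 1 w) (suc y) ∎
    where
    w≤d : All (_≤ d) w
    w≤d = All.map proj₂ w∈[d]

otYWord-rotWord : ∀ d w → All (InAlphabet d) w → AntiYamanouchi d w →
  otYWord (rotWord d w) ≡ rotWord (count d w) (otOppWord d w)
otYWord-rotWord d w w∈[d] A = begin
  otYWord (rotWord d w)                                     ≡⟨ otYWord≡labelOccurrences (rotWord d w) ⟩
  labelOccurrences otYLabel [] (rotWord d w)                ≡⟨ labelOccurrences-rotWord otYLabel (otOppLabel d w) w w∈[d] label-rot ⟩
  rotWord (count d w) (labelOccurrences (otOppLabel d w) [] w) ≡⟨ cong (rotWord (count d w)) (otOppWord≡labelOccurrences d w) ⟨
  rotWord (count d w) (otOppWord d w)                       ∎
  where
  label-rot : ∀ a x y → InAlphabet d a → x + suc y ≡ count a w →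
    suc x ≡ rotLetter (count d w) (otOppLabel d w a y)
  label-rot a x y a∈[d] x+1+y≡ν = sym (begin
    rotLetter (count d w) ((count d w ∸ count a w) + suc y)
      ≡⟨ cong (rotLetter (count d w)) (occurrence-complement ν≤νd y+1+x≡ν) ⟩
    rotLetter (count d w) (rotLetter (count d w) (suc x))
      ≡⟨ rotLetter-involutive (s≤s (≤-trans (m≤m+n x (suc y)) (subst (_≤ count d w) (sym x+1+y≡ν) ν≤νd))) ⟩
    suc x ∎)
    where
    ν≤νd : count a w ≤ count d w
    ν≤νd = antiYamanouchi-count≤countK A a a∈[d]
    y+1+x≡ν : y + suc x ≡ count a w
    y+1+x≡ν = trans (+-suc y x) (trans (cong suc (+-comm y x)) (trans (sym (+-suc x y)) x+1+y≡ν))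

∸-suc-< : ∀ {n i} → i < n → n ∸ suc i < n
∸-suc-< {suc n} {i} _ = s≤s (m∸n≤m n i)

∸-suc-involutive : ∀ {n i} → i < n → n ∸ suc (n ∸ suc i) ≡ i
∸-suc-involutive {suc n} (s≤s i≤n) = m∸[m∸n]≡n i≤n

!-map : ∀ (f : ℕ → ℕ) xs {i} → i < length xs → map f xs ! i ≡ f (xs ! i)
!-map f (x ∷ xs) {zero} _ = refl
!-map f (x ∷ xs) {suc i} (s≤s i<n) = !-map f xs i<n

!-++ˡ : ∀ xs ys {i} → i < length xs → (xs ++ ys) ! i ≡ xs ! i
!-++ˡ (x ∷ xs) ys {zero} _ = refl
!-++ˡ (x ∷ xs) ys {suc i} (s≤s i<n) = !-++ˡ xs ys i<n

!-++ʳ : ∀ xs ys i → (xs ++ ys) ! (length xs + i) ≡ ys ! i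
!-++ʳ [] ys i = refl
!-++ʳ (x ∷ xs) ys i = !-++ʳ xs ys i

!-reverse : ∀ xs {i} → i < length xs → reverse xs ! i ≡ xs ! (length xs ∸ suc i)
!-reverse (x ∷ xs) {i} i≤n rewrite unfold-reverse x xs with <-cmp i (length xs)
... | tri< i<n _ _ = begin
  (reverse xs ++ [ x ]) ! i          ≡⟨ !-++ˡ (reverse xs) [ x ] (subst (i <_) (sym (length-reverse xs)) i<n) ⟩
  reverse xs ! i                     ≡⟨ !-reverse xs i<n ⟩
  xs ! (length xs ∸ suc i)           ≡⟨ cong ((x ∷ xs) !_) (+-∸-assoc 1 i<n) ⟨
  (x ∷ xs) ! (length xs ∸ i)         ∎
... | tri≈ _ refl _ = begin
  (reverse xs ++ [ x ]) ! length xs  ≡⟨ cong ((reverse xs ++ [ x ]) !_) (trans (+-identityʳ _) (length-reverse xs)) ⟨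
  (reverse xs ++ [ x ]) ! (length (reverse xs) + 0)  ≡⟨ !-++ʳ (reverse xs) [ x ] 0 ⟩
  x                                  ≡⟨ cong ((x ∷ xs) !_) (n∸n≡0 (length xs)) ⟨
  (x ∷ xs) ! (length xs ∸ length xs) ∎
... | tri> _ _ n<i = ⊥-elim (<⇒≱ n<i (≤-pred i≤n))

!-reverse′ : ∀ xs {j} → j < length xs → reverse xs ! (length xs ∸ suc j) ≡ xs ! j
!-reverse′ xs j<n = trans (!-reverse xs (∸-suc-< j<n)) (cong (xs !_) (∸-suc-involutive j<n))

!-applyUpTo : ∀ (f : ℕ → ℕ) {n i} → i < n → applyUpTo f n ! i ≡ f i
!-applyUpTo f {suc n} {zero} _ = refl
!-applyUpTo f {suc n} {suc i} (s≤s i<n) = !-applyUpTo (f ∘ suc) i<n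

applyUpTo-cong : ∀ {A : Set} n {f g : ℕ → A} → (∀ {i} → i < n → f i ≡ g i) → applyUpTo f n ≡ applyUpTo g n
applyUpTo-cong zero f≗g = refl
applyUpTo-cong (suc n) f≗g = cong₂ _∷_ (f≗g (s≤s z≤n)) (applyUpTo-cong n (f≗g ∘ s≤s))

reverse-applyUpTo′ : ∀ {A : Set} n (f : ℕ → A) → reverse (applyUpTo f n) ≡ applyUpTo (λ i → f (n ∸ suc i)) n
reverse-applyUpTo′ zero f = refl
reverse-applyUpTo′ {A} (suc n) f = begin
  reverse (f 0 ∷ applyUpTo (f ∘ suc) n)           ≡⟨ unfold-reverse (f 0) (applyUpTo (f ∘ suc) n) ⟩
  reverse (applyUpTo (f ∘ suc) n) ∷ʳ f 0          ≡⟨ cong (_∷ʳ f 0) (reverse-applyUpTo′ n (f ∘ suc)) ⟩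
  applyUpTo (λ i → f (suc (n ∸ suc i))) n ∷ʳ f 0  ≡⟨ cong₂ _∷ʳ_ (applyUpTo-cong n (λ i<n → cong f (sym (+-∸-assoc 1 i<n))))
                                                                (cong f (sym (n∸n≡0 n))) ⟩
  applyUpTo g n ∷ʳ g n                            ≡⟨ applyUpTo-∷ʳ g n ⟩
  applyUpTo g (suc n)                             ∎
  where
  g : ℕ → A
  g i = f (suc n ∸ suc i)

reverse-concat-applyUpTo : ∀ {A : Set} n (F : ℕ → List A) →
  reverse (concat (applyUpTo F n)) ≡ concat (applyUpTo (λ i → reverse (F (n ∸ suc i))) n)
reverse-concat-applyUpTo n F = begin
  reverse (concat (applyUpTo F n))                           ≡⟨ reverse-concat (applyUpTo F n) ⟩
  concat (map reverse (reverse (applyUpTo F n)))             ≡⟨ cong (concat ∘ map reverse) (reverse-applyUpTo′ n F) ⟩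
  concat (map reverse (applyUpTo (λ i → F (n ∸ suc i)) n))   ≡⟨ cong concat (map-applyUpTo (λ i → F (n ∸ suc i)) reverse n) ⟩
  concat (applyUpTo (λ i → reverse (F (n ∸ suc i))) n)       ∎

map-concat-applyUpTo : ∀ {A B : Set} (h : A → B) n (F : ℕ → List A) →
  map h (concat (applyUpTo F n)) ≡ concat (applyUpTo (map h ∘ F) n)
map-concat-applyUpTo h n F = trans (sym (concat-map (applyUpTo F n))) (cong concat (map-applyUpTo F (map h) n))

Cell : Set
Cell = ℕ × ℕ

_≟ᶜ_ : (p q : Cell) → Dec (p ≡ q)
_≟ᶜ_ = Product.≡-dec _≟_ _≟_

≡ᵇ-refl : ∀ n → (n ≡ᵇ n) ≡ true
≡ᵇ-refl zero = refl
≡ᵇ-refl (suc n) = ≡ᵇ-refl n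

indexOf-here : ∀ p L → indexOf p (p ∷ L) ≡ 0
indexOf-here (r , c) L rewrite ≡ᵇ-refl r | ≡ᵇ-refl c = refl

indexOf-there : ∀ {p q} L → p ≢ q → indexOf p (q ∷ L) ≡ suc (indexOf p L)
indexOf-there {r , c} {r′ , c′} L p≢q with r ≡ᵇ r′ in r≡r′ | c ≡ᵇ c′ in c≡c′
... | false | _ = refl
... | true | false = refl
... | true | true = ⊥-elim (p≢q (cong₂ _,_ (≡ᵇ⇒≡ r r′ (subst T (sym r≡r′) _)) (≡ᵇ⇒≡ c c′ (subst T (sym c≡c′) _))))

indexOf<length : ∀ {p} L → p ∈ L → indexOf p L < length L
indexOf<length {p} (q ∷ L) p∈L with p ≟ᶜ q | p∈L
... | yes refl | _ = subst (_< suc (length L)) (sym (indexOf-here p L)) (s≤s z≤n)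
... | no p≢q | here p≡q = ⊥-elim (p≢q p≡q)
... | no p≢q | there p∈L′ = subst (_< suc (length L)) (sym (indexOf-there L p≢q)) (s≤s (indexOf<length L p∈L′))

indexOf-++ˡ : ∀ {p} L M → p ∈ L → indexOf p (L ++ M) ≡ indexOf p L
indexOf-++ˡ {p} (q ∷ L) M p∈L with p ≟ᶜ q | p∈L
... | yes refl | _ = trans (indexOf-here p (L ++ M)) (sym (indexOf-here p L))
... | no p≢q | here p≡q = ⊥-elim (p≢q p≡q)
... | no p≢q | there p∈L′ = begin
  indexOf p (q ∷ L ++ M)    ≡⟨ indexOf-there (L ++ M) p≢q ⟩
  suc (indexOf p (L ++ M))  ≡⟨ cong suc (indexOf-++ˡ L M p∈L′) ⟩
  suc (indexOf p L)         ≡⟨ indexOf-there L p≢q ⟨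
  indexOf p (q ∷ L)         ∎

indexOf-++ʳ : ∀ {p} L M → p ∉ L → indexOf p (L ++ M) ≡ length L + indexOf p M
indexOf-++ʳ [] M _ = refl
indexOf-++ʳ {p} (q ∷ L) M p∉L with p ≟ᶜ q
... | yes p≡q = ⊥-elim (p∉L (here p≡q))
... | no p≢q = trans (indexOf-there (L ++ M) p≢q) (cong suc (indexOf-++ʳ L M (p∉L ∘ there)))

indexOf-reverse : ∀ {p} L → Unique L → p ∈ L → indexOf p (reverse L) + suc (indexOf p L) ≡ length L
indexOf-reverse {p} (q ∷ L) (q∉L ∷ L!) p∈L with p ≟ᶜ q | p∈L
... | yes refl | _ = begin
  indexOf p (reverse (p ∷ L)) + suc (indexOf p (p ∷ L))
    ≡⟨ cong₂ (λ M i → indexOf p M + suc i) (unfold-reverse p L) (indexOf-here p L) ⟩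
  indexOf p (reverse L ++ [ p ]) + 1
    ≡⟨ cong (_+ 1) (indexOf-++ʳ (reverse L) [ p ] (λ p∈rL → All.lookup q∉L (Any.reverse⁻ p∈rL) refl)) ⟩
  (length (reverse L) + indexOf p [ p ]) + 1
    ≡⟨ cong₂ (λ n i → (n + i) + 1) (length-reverse L) (indexOf-here p []) ⟩
  (length L + 0) + 1
    ≡⟨ trans (cong (_+ 1) (+-identityʳ (length L))) (+-comm (length L) 1) ⟩
  suc (length L) ∎
... | no p≢q | here p≡q = ⊥-elim (p≢q p≡q)
... | no p≢q | there p∈L′ = begin
  indexOf p (reverse (q ∷ L)) + suc (indexOf p (q ∷ L))
    ≡⟨ cong₂ (λ M i → indexOf p M + suc i) (unfold-reverse q L) (indexOf-there L p≢q) ⟩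
  indexOf p (reverse L ++ [ q ]) + suc (suc (indexOf p L))
    ≡⟨ cong (_+ suc (suc (indexOf p L))) (indexOf-++ˡ (reverse L) [ q ] (Any.reverse⁺ p∈L′)) ⟩
  indexOf p (reverse L) + suc (suc (indexOf p L))
    ≡⟨ +-suc (indexOf p (reverse L)) (suc (indexOf p L)) ⟩
  suc (indexOf p (reverse L) + suc (indexOf p L))
    ≡⟨ cong suc (indexOf-reverse L L! p∈L′) ⟩
  suc (length L) ∎

indexOf-map : ∀ (f : Cell → Cell) p L → All (λ q → f q ≡ f p → q ≡ p) L → indexOf (f p) (map f L) ≡ indexOf p L
indexOf-map f p [] [] = refl
indexOf-map f p (q ∷ L) (fq≡fp⇒q≡p ∷ rest) with p ≟ᶜ q
... | yes refl = trans (indexOf-here (f p) (map f L)) (sym (indexOf-here p L))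
... | no p≢q = begin
  indexOf (f p) (f q ∷ map f L)   ≡⟨ indexOf-there (map f L) (λ fp≡fq → p≢q (sym (fq≡fp⇒q≡p (sym fp≡fq)))) ⟩
  suc (indexOf (f p) (map f L))   ≡⟨ cong suc (indexOf-map f p L rest) ⟩
  suc (indexOf p L)               ≡⟨ indexOf-there L p≢q ⟨
  indexOf p (q ∷ L)               ∎

cellsAt : List ℕ → List ℕ → ℕ → ℕ → List Cell
cellsAt la mu r c = if (mu ! r ≤ᵇ c) ∧ (c <ᵇ la ! r) then [ (r , c) ] else []

columnCells : List ℕ → List ℕ → ℕ → List Cell
columnCells la mu c = concat (applyUpTo (λ r → cellsAt la mu r c) (length la))

colCells-columns : ∀ C la mu → colCells C la mu ≡ concat (applyUpTo (λ i → columnCells la mu (C ∸ suc i)) C)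
colCells-columns C la mu = begin
  concat (map (λ c → concat (map (λ r → cellsAt la mu r c) (upTo (length la)))) (reverse (upTo C)))
    ≡⟨ cong concat (map-cong (λ c → cong concat (map-upTo (λ r → cellsAt la mu r c) (length la))) (reverse (upTo C))) ⟩
  concat (map (columnCells la mu) (reverse (upTo C)))
    ≡⟨ cong (concat ∘ map (columnCells la mu)) (reverse-applyUpTo′ C (λ i → i)) ⟩
  concat (map (columnCells la mu) (applyUpTo (λ i → C ∸ suc i) C))
    ≡⟨ cong concat (map-applyUpTo (λ i → C ∸ suc i) (columnCells la mu) C) ⟩
  concat (applyUpTo (λ i → columnCells la mu (C ∸ suc i)) C) ∎

module _ (C : ℕ) (la mu : List ℕ) where

  private
    R = length la

    cellsAt-≡ : ∀ r c → All (_≡ (r , c)) (cellsAt la mu r c)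
    cellsAt-≡ r c with (mu ! r ≤ᵇ c) ∧ (c <ᵇ la ! r)
    ... | true = refl ∷ []
    ... | false = []

    columnCells-column : ∀ c → All (λ p → proj₁ p < R × proj₂ p ≡ c) (columnCells la mu c)
    columnCells-column c = All.concat⁺ (All.applyUpTo⁺₁ (λ r → cellsAt la mu r c) R
      (λ {r} r<R → All.map (λ { refl → r<R , refl }) (cellsAt-≡ r c)))

    columnCells-unique : ∀ c → Unique (columnCells la mu c)
    columnCells-unique c = Unique.concat⁺
      (All.applyUpTo⁺₂ (λ r → cellsAt la mu r c) R singleton-unique)
      (AllPairs.applyUpTo⁺₁ (λ r → cellsAt la mu r c) R disjoint)
      where
      singleton-unique : ∀ r → Unique (cellsAt la mu r c)
      singleton-unique r with (mu ! r ≤ᵇ c) ∧ (c <ᵇ la ! r)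
      ... | true = [] ∷ []
      ... | false = []
      disjoint : ∀ {i j} → i < j → j < R → ∀ {p} → ¬ (p ∈ cellsAt la mu i c × p ∈ cellsAt la mu j c)
      disjoint i<j _ (p∈i , p∈j) with All.lookup (cellsAt-≡ _ c) p∈i | All.lookup (cellsAt-≡ _ c) p∈j
      ... | refl | i≡j = <⇒≢ i<j (cong proj₁ i≡j)

  colCells-bounded : All (λ p → proj₁ p < R × proj₂ p < C) (colCells C la mu)
  colCells-bounded = subst (All _) (sym (colCells-columns C la mu))
    (All.concat⁺ (All.applyUpTo⁺₁ (λ i → columnCells la mu (C ∸ suc i)) C
      (λ i<C → All.map (λ { (r<R , refl) → r<R , ∸-suc-< i<C }) (columnCells-column _))))

  colCells-unique : Unique (colCells C la mu)
  colCells-unique = subst Unique (sym (colCells-columns C la mu)) (Unique.concat⁺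
    (All.applyUpTo⁺₂ (λ i → columnCells la mu (C ∸ suc i)) C (λ i → columnCells-unique (C ∸ suc i)))
    (AllPairs.applyUpTo⁺₁ (λ i → columnCells la mu (C ∸ suc i)) C disjoint))
    where
    disjoint : ∀ {i j} → i < j → j < C → ∀ {p} → ¬ (p ∈ columnCells la mu (C ∸ suc i) × p ∈ columnCells la mu (C ∸ suc j))
    disjoint i<j j<C (p∈i , p∈j) with All.lookup (columnCells-column _) p∈i | All.lookup (columnCells-column _) p∈j
    ... | (_ , c≡i′) | (_ , c≡j′) = <⇒≢ i<j (suc-injective (∸-cancelˡ-≡ (<-trans i<j j<C) j<C (trans (sym c≡i′) c≡j′)))

  ∈-colCells : ∀ {r c} → r < R → mu ! r ≤ c → c < la ! r → la ! r ≤ C → (r , c) ∈ colCells C la mu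
  ∈-colCells {r} {c} r<R mu≤c c<la la≤C = subst ((r , c) ∈_) (sym (colCells-columns C la mu))
    (Any.concat⁺ (Any.applyUpTo⁺ (λ i → columnCells la mu (C ∸ suc i)) ∈-column (∸-suc-< c<C)))
    where
    c<C : c < C
    c<C = <-≤-trans c<la la≤C
    ∈-cellsAt : (r , c) ∈ cellsAt la mu r c
    ∈-cellsAt rewrite Equivalence.to T-≡ (≤⇒≤ᵇ mu≤c) | Equivalence.to T-≡ (<⇒<ᵇ c<la) = here refl
    ∈-column : (r , c) ∈ columnCells la mu (C ∸ suc (C ∸ suc c))
    ∈-column = subst (λ c′ → (r , c) ∈ columnCells la mu c′) (sym (∸-suc-involutive c<C))
      (Any.concat⁺ (Any.applyUpTo⁺ (λ r′ → cellsAt la mu r′ c) ∈-cellsAt r<R))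

rotPartition : ℕ → List ℕ → List ℕ
rotPartition C xs = map (C ∸_) (reverse xs)

rotCell : ℕ → ℕ → Cell → Cell
rotCell R C (r , c) = (R ∸ suc r , C ∸ suc c)

map-reverse-if : ∀ (h : Cell → Cell) b p → map h (reverse (if b then [ p ] else [])) ≡ (if b then [ h p ] else [])
map-reverse-if h true p = refl
map-reverse-if h false p = refl

T-injective : ∀ {b b′} → (T b → T b′) → (T b′ → T b) → b ≡ b′
T-injective {true} {true} _ _ = refl
T-injective {true} {false} to _ = ⊥-elim (to _)
T-injective {false} {true} _ from = ⊥-elim (from _)
T-injective {false} {false} _ _ = refl

∸-≤ᵇ-∸ : ∀ {C p i} → i < C → (C ∸ p ≤ᵇ C ∸ suc i) ≡ (i <ᵇ p)
∸-≤ᵇ-∸ {C} {p} {i} i<C = T-injective to from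
  where
  to : T (C ∸ p ≤ᵇ C ∸ suc i) → T (i <ᵇ p)
  to t with i <? p
  ... | yes i<p = <⇒<ᵇ i<p
  ... | no i≮p = ⊥-elim (<⇒≱ (∸-monoʳ-< (s≤s (≮⇒≥ i≮p)) i<C) (≤ᵇ⇒≤ _ _ t))
  from : T (i <ᵇ p) → T (C ∸ p ≤ᵇ C ∸ suc i)
  from t = ≤⇒≤ᵇ (∸-monoʳ-≤ C (<ᵇ⇒< i p t))

∸-<ᵇ-∸ : ∀ {C q i} → i < C → (C ∸ suc i <ᵇ C ∸ q) ≡ (q ≤ᵇ i)
∸-<ᵇ-∸ {C} {q} {i} i<C = T-injective to from
  where
  to : T (C ∸ suc i <ᵇ C ∸ q) → T (q ≤ᵇ i)
  to t with q ≤? i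
  ... | yes q≤i = ≤⇒≤ᵇ q≤i
  ... | no q≰i = ⊥-elim (<⇒≱ (<ᵇ⇒< _ _ t) (∸-monoʳ-≤ C (≰⇒> q≰i)))
  from : T (q ≤ᵇ i) → T (C ∸ suc i <ᵇ C ∸ q)
  from t = <⇒<ᵇ (∸-monoʳ-< {o = q} (s≤s (≤ᵇ⇒≤ _ _ t)) i<C)

m∸[n∸o]≡m∸n+o : ∀ {m n o} → o ≤ n → n ≤ m → m ∸ (n ∸ o) ≡ (m ∸ n) + o
m∸[n∸o]≡m∸n+o {m} {n} {o} o≤n n≤m = begin
  m ∸ (n ∸ o)                          ≡⟨ cong (_∸ (n ∸ o)) split ⟨
  ((m ∸ n) + o) + (n ∸ o) ∸ (n ∸ o)    ≡⟨ m+n∸n≡m ((m ∸ n) + o) (n ∸ o) ⟩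
  (m ∸ n) + o                          ∎
  where
  split : ((m ∸ n) + o) + (n ∸ o) ≡ m
  split = trans (+-assoc (m ∸ n) o (n ∸ o)) (trans (cong ((m ∸ n) +_) (m+[n∸m]≡n o≤n)) (m∸n+n≡m n≤m))

[m∸o]∸[m∸n]≡n∸o : ∀ {m n o} → n ≤ m → o ≤ m → (m ∸ o) ∸ (m ∸ n) ≡ n ∸ o
[m∸o]∸[m∸n]≡n∸o {m} {n} {o} n≤m o≤m with ≤-total o n
... | inj₁ o≤n = begin
  (m ∸ o) ∸ (m ∸ n)                  ≡⟨ cong (λ k → (m ∸ k) ∸ (m ∸ n)) (m∸[m∸n]≡n o≤n) ⟨
  (m ∸ (n ∸ (n ∸ o))) ∸ (m ∸ n)      ≡⟨ cong (_∸ (m ∸ n)) (m∸[n∸o]≡m∸n+o (m∸n≤m n o) n≤m) ⟩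
  ((m ∸ n) + (n ∸ o)) ∸ (m ∸ n)      ≡⟨ m+n∸m≡n (m ∸ n) (n ∸ o) ⟩
  n ∸ o                              ∎
... | inj₂ n≤o = trans (m≤n⇒m∸n≡0 (∸-monoʳ-≤ m n≤o)) (sym (m≤n⇒m∸n≡0 n≤o))

suc[q+[[p∸q]∸suc[t]]]≡p∸t : ∀ {p q t} → t < p ∸ q → suc (q + ((p ∸ q) ∸ suc t)) ≡ p ∸ t
suc[q+[[p∸q]∸suc[t]]]≡p∸t {p} {q} {t} t<p∸q = begin
  suc (q + ((p ∸ q) ∸ suc t))  ≡⟨ +-suc q ((p ∸ q) ∸ suc t) ⟨
  q + suc ((p ∸ q) ∸ suc t)    ≡⟨ cong (q +_) (+-∸-assoc 1 t<p∸q) ⟨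
  q + ((p ∸ q) ∸ t)            ≡⟨ +-∸-assoc q (<⇒≤ t<p∸q) ⟨
  (q + (p ∸ q)) ∸ t            ≡⟨ cong (_∸ t) (m+[n∸m]≡n q≤p) ⟩
  p ∸ t                        ∎
  where
  q≤p : q ≤ p
  q≤p with ≤-total q p
  ... | inj₁ q≤p = q≤p
  ... | inj₂ p≤q with () ← subst (t <_) (m≤n⇒m∸n≡0 p≤q) t<p∸q

!-rotPartition : ∀ C xs {r} → r < length xs → rotPartition C xs ! r ≡ C ∸ xs ! (length xs ∸ suc r)
!-rotPartition C xs {r} r<n =
  trans (!-map (C ∸_) (reverse xs) (subst (r <_) (sym (length-reverse xs)) r<n)) (cong (C ∸_) (!-reverse xs r<n))

length-rotPartition : ∀ C xs → length (rotPartition C xs) ≡ length xs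
length-rotPartition C xs = trans (length-map (C ∸_) (reverse xs)) (length-reverse xs)

filledRow : ℕ → List ℕ → List ℕ → List ℕ → ℕ → List ℕ
filledRow C la mu u r = applyUpTo (λ t → u ! indexOf (r , mu ! r + t) (colCells C la mu)) (la ! r ∸ mu ! r)

fillByColWord-rows : ∀ C la mu u → fillByColWord C la mu u ≡ applyUpTo (filledRow C la mu u) (length la)
fillByColWord-rows C la mu u = trans (map-upTo _ (length la))
  (applyUpTo-cong (length la) (λ {r} _ → trans (sym (map-∘ (upTo (la ! r ∸ mu ! r)))) (map-upTo _ _)))

module RotatedShape (C : ℕ) (la mu : List ℕ) (|mu|≡|la| : length mu ≡ length la)
  (la≤C : ∀ {r} → r < length la → la ! r ≤ C) (mu≤C : ∀ {r} → r < length la → mu ! r ≤ C) where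

  R = length la
  la′ = rotPartition C mu
  mu′ = rotPartition C la
  L = colCells C la mu
  L′ = colCells C la′ mu′
  N = length L

  length-la′ : length la′ ≡ R
  length-la′ = trans (length-rotPartition C mu) |mu|≡|la|

  mu′-! : ∀ {r} → r < R → mu′ ! r ≡ C ∸ la ! (R ∸ suc r)
  mu′-! = !-rotPartition C la

  la′-! : ∀ {r} → r < R → la′ ! r ≡ C ∸ mu ! (R ∸ suc r)
  la′-! {r} r<R = trans (!-rotPartition C mu (subst (r <_) (sym |mu|≡|la|) r<R)) (cong (λ n → C ∸ mu ! (n ∸ suc r)) |mu|≡|la|)

  cellsAt-rot : ∀ {i r} → i < C → r < R → cellsAt la′ mu′ r (C ∸ suc i) ≡ map (rotCell R C) (reverse (cellsAt la mu (R ∸ suc r) i))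
  cellsAt-rot {i} {r} i<C r<R = begin
    (if (mu′ ! r ≤ᵇ C ∸ suc i) ∧ (C ∸ suc i <ᵇ la′ ! r) then [ (r , C ∸ suc i) ] else [])
      ≡⟨ cong₂ (λ b p → if b then [ p ] else []) test-rot (cong (_, C ∸ suc i) (sym (∸-suc-involutive r<R))) ⟩
    (if (mu ! r′ ≤ᵇ i) ∧ (i <ᵇ la ! r′) then [ rotCell R C (r′ , i) ] else [])
      ≡⟨ map-reverse-if (rotCell R C) ((mu ! r′ ≤ᵇ i) ∧ (i <ᵇ la ! r′)) (r′ , i) ⟨
    map (rotCell R C) (reverse (cellsAt la mu r′ i)) ∎
    where
    r′ = R ∸ suc r
    test-rot : (mu′ ! r ≤ᵇ C ∸ suc i) ∧ (C ∸ suc i <ᵇ la′ ! r) ≡ (mu ! r′ ≤ᵇ i) ∧ (i <ᵇ la ! r′)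
    test-rot = begin
      (mu′ ! r ≤ᵇ C ∸ suc i) ∧ (C ∸ suc i <ᵇ la′ ! r)
        ≡⟨ cong₂ (λ m n → (m ≤ᵇ C ∸ suc i) ∧ (C ∸ suc i <ᵇ n)) (mu′-! r<R) (la′-! r<R) ⟩
      (C ∸ la ! r′ ≤ᵇ C ∸ suc i) ∧ (C ∸ suc i <ᵇ C ∸ mu ! r′)
        ≡⟨ cong₂ _∧_ (∸-≤ᵇ-∸ {p = la ! r′} i<C) (∸-<ᵇ-∸ {q = mu ! r′} i<C) ⟩
      (i <ᵇ la ! r′) ∧ (mu ! r′ ≤ᵇ i)
        ≡⟨ ∧-comm (i <ᵇ la ! r′) (mu ! r′ ≤ᵇ i) ⟩
      (mu ! r′ ≤ᵇ i) ∧ (i <ᵇ la ! r′) ∎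

  columnCells-rot : ∀ {i} → i < C → columnCells la′ mu′ (C ∸ suc i) ≡ map (rotCell R C) (reverse (columnCells la mu i))
  columnCells-rot {i} i<C = begin
    concat (applyUpTo (λ r → cellsAt la′ mu′ r (C ∸ suc i)) (length la′))
      ≡⟨ cong (concat ∘ applyUpTo (λ r → cellsAt la′ mu′ r (C ∸ suc i))) length-la′ ⟩
    concat (applyUpTo (λ r → cellsAt la′ mu′ r (C ∸ suc i)) R)
      ≡⟨ cong concat (applyUpTo-cong R (cellsAt-rot i<C)) ⟩
    concat (applyUpTo (λ r → map (rotCell R C) (reverse (cellsAt la mu (R ∸ suc r) i))) R)
      ≡⟨ map-concat-applyUpTo (rotCell R C) R (λ r → reverse (cellsAt la mu (R ∸ suc r) i)) ⟨
    map (rotCell R C) (concat (applyUpTo (λ r → reverse (cellsAt la mu (R ∸ suc r) i)) R))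
      ≡⟨ cong (map (rotCell R C)) (reverse-concat-applyUpTo R (λ r → cellsAt la mu r i)) ⟨
    map (rotCell R C) (reverse (columnCells la mu i)) ∎

  colCells-rot : L′ ≡ map (rotCell R C) (reverse L)
  colCells-rot = begin
    L′
      ≡⟨ colCells-columns C la′ mu′ ⟩
    concat (applyUpTo (λ i → columnCells la′ mu′ (C ∸ suc i)) C)
      ≡⟨ cong concat (applyUpTo-cong C (λ i<C → trans (columnCells-rot i<C)
           (cong (map (rotCell R C) ∘ reverse ∘ columnCells la mu) (sym (∸-suc-involutive i<C))))) ⟩
    concat (applyUpTo (λ i → map (rotCell R C) (reverse (columnCells la mu (C ∸ suc (C ∸ suc i))))) C)
      ≡⟨ map-concat-applyUpTo (rotCell R C) C (λ i → reverse (columnCells la mu (C ∸ suc (C ∸ suc i)))) ⟨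
    map (rotCell R C) (concat (applyUpTo (λ i → reverse (columnCells la mu (C ∸ suc (C ∸ suc i)))) C))
      ≡⟨ cong (map (rotCell R C)) (reverse-concat-applyUpTo C (λ i → columnCells la mu (C ∸ suc i))) ⟨
    map (rotCell R C) (reverse (concat (applyUpTo (λ i → columnCells la mu (C ∸ suc i)) C)))
      ≡⟨ cong (map (rotCell R C) ∘ reverse) (colCells-columns C la mu) ⟨
    map (rotCell R C) (reverse L) ∎

  module _ {r c} (r<R : r < R) (mu≤c : mu ! r ≤ c) (c<la : c < la ! r) where

    cell∈L : (r , c) ∈ L
    cell∈L = ∈-colCells C la mu r<R mu≤c c<la (la≤C r<R)

    indexOf-rotCell : indexOf (rotCell R C (r , c)) L′ + suc (indexOf (r , c) L) ≡ N
    indexOf-rotCell = begin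
      indexOf (rotCell R C (r , c)) L′ + suc (indexOf (r , c) L)
        ≡⟨ cong (λ M → indexOf (rotCell R C (r , c)) M + suc (indexOf (r , c) L)) colCells-rot ⟩
      indexOf (rotCell R C (r , c)) (map (rotCell R C) (reverse L)) + suc (indexOf (r , c) L)
        ≡⟨ cong (_+ suc (indexOf (r , c) L)) (indexOf-map (rotCell R C) (r , c) (reverse L) rotCell-injective) ⟩
      indexOf (r , c) (reverse L) + suc (indexOf (r , c) L)
        ≡⟨ indexOf-reverse L (colCells-unique C la mu) cell∈L ⟩
      N ∎
      where
      c<C : c < C
      c<C = <-≤-trans c<la (la≤C r<R)
      rotCell-injective : All (λ q → rotCell R C q ≡ rotCell R C (r , c) → q ≡ (r , c)) (reverse L)
      rotCell-injective = All.tabulate (λ q∈rL → injective (All.lookup (colCells-bounded C la mu) (Any.reverse⁻ q∈rL)))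
        where
        injective : ∀ {q} → proj₁ q < R × proj₂ q < C → rotCell R C q ≡ rotCell R C (r , c) → q ≡ (r , c)
        injective (r′<R , c′<C) eq =
          cong₂ _,_ (suc-injective (∸-cancelˡ-≡ r′<R r<R (cong proj₁ eq))) (suc-injective (∸-cancelˡ-≡ c′<C c<C (cong proj₂ eq)))

  fillByColWord-rot : ∀ (g : ℕ → ℕ) v → length v ≡ N →
    fillByColWord C la′ mu′ (reverse (map g v)) ≡ reverse (map (reverse ∘ map g) (fillByColWord C la mu v))
  fillByColWord-rot g v |v|≡N = begin
    fillByColWord C la′ mu′ u                           ≡⟨ fillByColWord-rows C la′ mu′ u ⟩
    applyUpTo (filledRow C la′ mu′ u) (length la′)      ≡⟨ cong (applyUpTo (filledRow C la′ mu′ u)) length-la′ ⟩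
    applyUpTo (filledRow C la′ mu′ u) R                 ≡⟨ applyUpTo-cong R filledRow-rot ⟩
    applyUpTo (λ r → F (filledRow C la mu v (R ∸ suc r))) R
                                                        ≡⟨ reverse-applyUpTo′ R (F ∘ filledRow C la mu v) ⟨
    reverse (applyUpTo (F ∘ filledRow C la mu v) R)     ≡⟨ cong reverse (map-applyUpTo (filledRow C la mu v) F R) ⟨
    reverse (map F (applyUpTo (filledRow C la mu v) R)) ≡⟨ cong (reverse ∘ map F) (fillByColWord-rows C la mu v) ⟨
    reverse (map F (fillByColWord C la mu v))           ∎
    where
    u = reverse (map g v)
    F : List ℕ → List ℕ
    F = reverse ∘ map g
    |gv|≡N : length (map g v) ≡ N
    |gv|≡N = trans (length-map g v) |v|≡N

    filledRow-rot : ∀ {r} → r < R → filledRow C la′ mu′ u r ≡ F (filledRow C la mu v (R ∸ suc r))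
    filledRow-rot {r} r<R = begin
      applyUpTo (λ t → u ! indexOf (r , mu′ ! r + t) L′) (la′ ! r ∸ mu′ ! r)
        ≡⟨ cong₂ (λ m n → applyUpTo (λ t → u ! indexOf (r , m + t) L′) n) (mu′-! r<R)
             (trans (cong₂ _∸_ (la′-! r<R) (mu′-! r<R)) ([m∸o]∸[m∸n]≡n∸o p≤C q≤C)) ⟩
      applyUpTo (λ t → u ! indexOf (r , (C ∸ p) + t) L′) (p ∸ q)
        ≡⟨ applyUpTo-cong (p ∸ q) entry-rot ⟩
      applyUpTo (λ t → g (v ! indexOf (r′ , q + ((p ∸ q) ∸ suc t)) L)) (p ∸ q)
        ≡⟨ reverse-applyUpTo′ (p ∸ q) (λ t → g (v ! indexOf (r′ , q + t) L)) ⟨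
      reverse (applyUpTo (λ t → g (v ! indexOf (r′ , q + t) L)) (p ∸ q))
        ≡⟨ cong reverse (map-applyUpTo (λ t → v ! indexOf (r′ , q + t) L) g (p ∸ q)) ⟨
      F (filledRow C la mu v r′) ∎
      where
      r′ = R ∸ suc r
      r′<R = ∸-suc-< r<R
      p = la ! r′
      q = mu ! r′
      p≤C = la≤C r′<R
      q≤C = mu≤C r′<R

      entry-rot : ∀ {t} → t < p ∸ q → u ! indexOf (r , (C ∸ p) + t) L′ ≡ g (v ! indexOf (r′ , q + ((p ∸ q) ∸ suc t)) L)
      entry-rot {t} t<p∸q = begin
        u ! indexOf (r , (C ∸ p) + t) L′
          ≡⟨ cong₂ (λ a b → u ! indexOf (a , b) L′) (sym (∸-suc-involutive r<R)) column-rot ⟩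
        u ! indexOf (rotCell R C (r′ , c)) L′
          ≡⟨ cong (u !_) (trans (sym (m+n∸n≡m _ (suc j))) (cong (_∸ suc j) (indexOf-rotCell r′<R q≤c c<p))) ⟩
        u ! (N ∸ suc j)
          ≡⟨ cong (λ n → u ! (n ∸ suc j)) |gv|≡N ⟨
        reverse (map g v) ! (length (map g v) ∸ suc j)
          ≡⟨ !-reverse′ (map g v) (subst (j <_) (sym |gv|≡N) j<N) ⟩
        map g v ! j
          ≡⟨ !-map g v (subst (j <_) (sym |v|≡N) j<N) ⟩
        g (v ! j) ∎
        where
        c = q + ((p ∸ q) ∸ suc t)
        1+c≡p∸t : suc c ≡ p ∸ t
        1+c≡p∸t = suc[q+[[p∸q]∸suc[t]]]≡p∸t {q = q} t<p∸q
        q≤c : q ≤ c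
        q≤c = m≤m+n q _
        c<p : c < p
        c<p = subst (_≤ p) (sym 1+c≡p∸t) (m∸n≤m p t)
        column-rot : (C ∸ p) + t ≡ C ∸ suc c
        column-rot = trans (sym (m∸[n∸o]≡m∸n+o (<⇒≤ (<-≤-trans t<p∸q (m∸n≤m p q))) p≤C)) (cong (C ∸_) (sym 1+c≡p∸t))
        j = indexOf (r′ , c) L
        j<N : j < N
        j<N = indexOf<length L (cell∈L r′<R q≤c c<p)

countAbove : ℕ → List ℕ → ℕ
countAbove j xs = length (filter (suc j ≤?_) xs)

conj-! : ∀ m xs {k} → k < m → conj m xs ! k ≡ countAbove k xs
conj-! m xs k<m = trans (cong (_! _) (map-upTo (λ j → countAbove j xs) m)) (!-applyUpTo (λ j → countAbove j xs) k<m)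

length-conj : ∀ m xs → length (conj m xs) ≡ m
length-conj m xs = trans (length-map _ (upTo m)) (length-upTo m)

countAbove-∷-< : ∀ {j x xs} → j < x → countAbove j (x ∷ xs) ≡ suc (countAbove j xs)
countAbove-∷-< {j} j<x = cong length (filter-accept (suc j ≤?_) j<x)

countAbove-∷-≮ : ∀ {j x xs} → ¬ j < x → countAbove j (x ∷ xs) ≡ countAbove j xs
countAbove-∷-≮ {j} j≮x = cong length (filter-reject (suc j ≤?_) j≮x)

countAbove-reverse : ∀ j xs → countAbove j (reverse xs) ≡ countAbove j xs
countAbove-reverse j = length-filter-reverse (suc j ≤?_)

countAbove≤length : ∀ j xs → countAbove j xs ≤ length xs
countAbove≤length j = length-filter (suc j ≤?_)

m≤o∸n⇒n≤o∸m : ∀ {m n o} → n ≤ o → m ≤ o ∸ n → n ≤ o ∸ m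
m≤o∸n⇒n≤o∸m {m} {n} {o} n≤o m≤o∸n = m+n≤o⇒m≤o∸n n (subst (_≤ o) (+-comm m n) (m≤o∸n⇒m+n≤o m n≤o m≤o∸n))

-- Every part x ≤ m satisfies exactly one of  j < m ∸ x  and  m ∸ suc j < x.
countAbove-complement : ∀ m j xs → All (_≤ m) xs → j < m →
  countAbove j (map (m ∸_) xs) + countAbove (m ∸ suc j) xs ≡ length xs
countAbove-complement m j [] _ _ = refl
countAbove-complement m j (x ∷ xs) (x≤m ∷ xs≤m) j<m with suc j ≤? m ∸ x | suc (m ∸ suc j) ≤? x
... | yes j<m∸x | yes m∸suc[j]<x = ⊥-elim (<⇒≱ m∸suc[j]<x (m≤o∸n⇒n≤o∸m x≤m j<m∸x))
... | yes j<m∸x | no m∸suc[j]≮x =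
  trans (cong₂ _+_ (countAbove-∷-< j<m∸x) (countAbove-∷-≮ m∸suc[j]≮x)) (cong suc (countAbove-complement m j xs xs≤m j<m))
... | no j≮m∸x | yes m∸suc[j]<x =
  trans (cong₂ _+_ (countAbove-∷-≮ j≮m∸x) (countAbove-∷-< m∸suc[j]<x)) (trans (+-suc _ _) (cong suc (countAbove-complement m j xs xs≤m j<m)))
... | no j≮m∸x | no m∸suc[j]≮x = ⊥-elim (j≮m∸x (m≤o∸n⇒n≤o∸m j<m (≮⇒≥ m∸suc[j]≮x)))

conj-rotPartition : ∀ d m xs → length xs ≡ d → All (_≤ m) xs → conj m (rotPartition m xs) ≡ rotPartition d (conj m xs)
conj-rotPartition d m xs |xs|≡d xs≤m = begin
  conj m (rotPartition m xs)                                   ≡⟨ map-upTo (λ j → countAbove j (rotPartition m xs)) m ⟩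
  applyUpTo (λ j → countAbove j (rotPartition m xs)) m         ≡⟨ applyUpTo-cong m countAbove-rot ⟩
  applyUpTo (λ j → d ∸ countAbove (m ∸ suc j) xs) m            ≡⟨ map-applyUpTo (λ j → countAbove (m ∸ suc j) xs) (d ∸_) m ⟨
  map (d ∸_) (applyUpTo (λ j → countAbove (m ∸ suc j) xs) m)   ≡⟨ cong (map (d ∸_)) (reverse-applyUpTo′ m (λ j → countAbove j xs)) ⟨
  map (d ∸_) (reverse (applyUpTo (λ j → countAbove j xs) m))   ≡⟨ cong (rotPartition d) (map-upTo (λ j → countAbove j xs) m) ⟨
  rotPartition d (conj m xs)                                   ∎
  where
  countAbove-rot : ∀ {j} → j < m → countAbove j (rotPartition m xs) ≡ d ∸ countAbove (m ∸ suc j) xs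
  countAbove-rot {j} j<m = begin
    countAbove j (map (m ∸_) (reverse xs))          ≡⟨ cong (countAbove j) (reverse-map (m ∸_) xs) ⟩
    countAbove j (reverse (map (m ∸_) xs))          ≡⟨ countAbove-reverse j (map (m ∸_) xs) ⟩
    countAbove j (map (m ∸_) xs)                    ≡⟨ m+n∸n≡m _ (countAbove (m ∸ suc j) xs) ⟨
    (countAbove j (map (m ∸_) xs) + countAbove (m ∸ suc j) xs) ∸ countAbove (m ∸ suc j) xs
      ≡⟨ cong (_∸ countAbove (m ∸ suc j) xs) (trans (countAbove-complement m j xs xs≤m j<m) |xs|≡d) ⟩
    d ∸ countAbove (m ∸ suc j) xs                   ∎

∑ : ℕ → (ℕ → ℕ) → ℕ
∑ zero f = 0
∑ (suc n) f = f 0 + ∑ n (f ∘ suc)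

∑-cong : ∀ n {f g} → (∀ {i} → i < n → f i ≡ g i) → ∑ n f ≡ ∑ n g
∑-cong zero f≗g = refl
∑-cong (suc n) f≗g = cong₂ _+_ (f≗g (s≤s z≤n)) (∑-cong n (f≗g ∘ s≤s))

∑-zero : ∀ n {f} → (∀ i → f i ≡ 0) → ∑ n f ≡ 0
∑-zero zero f≗0 = refl
∑-zero (suc n) f≗0 = cong₂ _+_ (f≗0 0) (∑-zero n (f≗0 ∘ suc))

∑-suc : ∀ n f → ∑ (suc n) f ≡ ∑ n f + f n
∑-suc zero f = +-comm (f 0) 0
∑-suc (suc n) f = trans (cong (f 0 +_) (∑-suc n (f ∘ suc))) (sym (+-assoc (f 0) _ _))

∑-reverse : ∀ n f → ∑ n (λ i → f (n ∸ suc i)) ≡ ∑ n f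
∑-reverse zero f = refl
∑-reverse (suc n) f = begin
  f n + ∑ n (λ i → f (n ∸ suc i))  ≡⟨ cong (f n +_) (∑-reverse n f) ⟩
  f n + ∑ n f                      ≡⟨ +-comm (f n) (∑ n f) ⟩
  ∑ n f + f n                      ≡⟨ ∑-suc n f ⟨
  ∑ (suc n) f                      ∎

∑-+ : ∀ n f g → ∑ n (λ i → f i + g i) ≡ ∑ n f + ∑ n g
∑-+ zero f g = refl
∑-+ (suc n) f g = trans (cong ((f 0 + g 0) +_) (∑-+ n (f ∘ suc) (g ∘ suc))) (interchange (f 0) (g 0) _ _)

∑-swap : ∀ n k (f : ℕ → ℕ → ℕ) → ∑ n (λ i → ∑ k (f i)) ≡ ∑ k (λ j → ∑ n (λ i → f i j))
∑-swap zero k f = sym (∑-zero k (λ _ → refl))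
∑-swap (suc n) k f = trans (cong (∑ k (f 0) +_) (∑-swap n k (f ∘ suc))) (sym (∑-+ k (f 0) (λ j → ∑ n (λ i → f (suc i) j))))

∑-∸ : ∀ n f g → (∀ {i} → i < n → g i ≤ f i) → ∑ n (λ i → f i ∸ g i) + ∑ n g ≡ ∑ n f
∑-∸ n f g g≤f = trans (sym (∑-+ n (λ i → f i ∸ g i) g)) (∑-cong n (λ i<n → m∸n+n≡m (g≤f i<n)))

length-concat-applyUpTo : ∀ {A : Set} n (F : ℕ → List A) → length (concat (applyUpTo F n)) ≡ ∑ n (length ∘ F)
length-concat-applyUpTo zero F = refl
length-concat-applyUpTo (suc n) F = trans (length-++ (F 0)) (cong (length (F 0) +_) (length-concat-applyUpTo n (F ∘ suc)))

length-if : ∀ b (p : Cell) → length (if b then [ p ] else []) ≡ (if b then 1 else 0)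
length-if true p = refl
length-if false p = refl

∑-interval : ∀ C {p} q → p ≤ C → ∑ C (λ c → if (q ≤ᵇ c) ∧ (c <ᵇ p) then 1 else 0) ≡ p ∸ q
∑-interval zero {zero} q _ = sym (0∸n≡0 q)
∑-interval (suc C) {zero} q _ = trans (∑-zero (suc C) (λ c → cong (λ b → if b then 1 else 0) (∧-zeroʳ (q ≤ᵇ c)))) (sym (0∸n≡0 q))
∑-interval (suc C) {suc p} zero (s≤s p≤C) = cong suc (∑-interval C zero p≤C)
∑-interval (suc C) {suc p} (suc q) (s≤s p≤C) =
  trans (∑-cong C (λ {c} _ → cong (λ b → if b ∧ (c <ᵇ p) then 1 else 0) (suc≤ᵇsuc q c))) (∑-interval C q p≤C)
  where
  suc≤ᵇsuc : ∀ q c → (suc q ≤ᵇ suc c) ≡ (q ≤ᵇ c)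
  suc≤ᵇsuc zero c = refl
  suc≤ᵇsuc (suc q) c = refl

length-colCells : ∀ C la mu → (∀ {r} → r < length la → la ! r ≤ C) →
  length (colCells C la mu) ≡ ∑ (length la) (λ r → la ! r ∸ mu ! r)
length-colCells C la mu la≤C = begin
  length (colCells C la mu)                                    ≡⟨ cong length (colCells-columns C la mu) ⟩
  length (concat (applyUpTo (λ i → columnCells la mu (C ∸ suc i)) C))
                                                               ≡⟨ length-concat-applyUpTo C (λ i → columnCells la mu (C ∸ suc i)) ⟩
  ∑ C (λ i → length (columnCells la mu (C ∸ suc i)))           ≡⟨ ∑-reverse C (length ∘ columnCells la mu) ⟩
  ∑ C (length ∘ columnCells la mu)                             ≡⟨ ∑-cong C (λ {c} _ → length-concat-applyUpTo R (λ r → cellsAt la mu r c)) ⟩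
  ∑ C (λ c → ∑ R (λ r → length (cellsAt la mu r c)))           ≡⟨ ∑-swap C R (λ c r → length (cellsAt la mu r c)) ⟩
  ∑ R (λ r → ∑ C (λ c → length (cellsAt la mu r c)))           ≡⟨ ∑-cong R row-length ⟩
  ∑ R (λ r → la ! r ∸ mu ! r)                                  ∎
  where
  R = length la
  row-length : ∀ {r} → r < R → ∑ C (λ c → length (cellsAt la mu r c)) ≡ la ! r ∸ mu ! r
  row-length {r} r<R = trans (∑-cong C (λ {c} _ → length-if ((mu ! r ≤ᵇ c) ∧ (c <ᵇ la ! r)) (r , c))) (∑-interval C (mu ! r) (la≤C r<R))

∑-countAbove : ∀ m xs → All (_≤ m) xs → ∑ m (λ k → countAbove k xs) ≡ ∑ (length xs) (xs !_)
∑-countAbove m [] _ = ∑-zero m (λ _ → refl)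
∑-countAbove m (x ∷ xs) (x≤m ∷ xs≤m) = begin
  ∑ m (λ k → countAbove k (x ∷ xs))                          ≡⟨ ∑-cong m (λ {k} _ → length-filter-++ (suc k ≤?_) [ x ] xs) ⟩
  ∑ m (λ k → countAbove k [ x ] + countAbove k xs)           ≡⟨ ∑-+ m _ _ ⟩
  ∑ m (λ k → countAbove k [ x ]) + ∑ m (λ k → countAbove k xs) ≡⟨ cong₂ _+_ (∑-countAbove-single m x≤m) (∑-countAbove m xs xs≤m) ⟩
  x + ∑ (length xs) (xs !_)                                  ∎
  where
  countAbove-suc : ∀ k y → countAbove (suc k) [ suc y ] ≡ countAbove k [ y ]
  countAbove-suc k y with k <? y
  ... | yes k<y = trans (countAbove-∷-< (s≤s k<y)) (sym (countAbove-∷-< k<y))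
  ... | no k≮y = trans (countAbove-∷-≮ (k≮y ∘ ≤-pred)) (sym (countAbove-∷-≮ k≮y))
  ∑-countAbove-single : ∀ m {y} → y ≤ m → ∑ m (λ k → countAbove k [ y ]) ≡ y
  ∑-countAbove-single m {zero} _ = ∑-zero m (λ _ → refl)
  ∑-countAbove-single (suc m) {suc y} (s≤s y≤m) =
    cong suc (trans (∑-cong m (λ {k} _ → countAbove-suc k y)) (∑-countAbove-single m y≤m))

countAbove-mono : ∀ k xs ys → length xs ≡ length ys → (∀ {i} → i < length xs → xs ! i ≤ ys ! i) → countAbove k xs ≤ countAbove k ys
countAbove-mono k [] ys _ _ = z≤n
countAbove-mono k (x ∷ xs) (y ∷ ys) |xs|≡|ys| xs≤ys = step (k <? x) (k <? y)
  where
  ih : countAbove k xs ≤ countAbove k ys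
  ih = countAbove-mono k xs ys (suc-injective |xs|≡|ys|) (xs≤ys ∘ s≤s)
  step : Dec (k < x) → Dec (k < y) → countAbove k (x ∷ xs) ≤ countAbove k (y ∷ ys)
  step (yes k<x) (yes k<y) = subst₂ _≤_ (sym (countAbove-∷-< k<x)) (sym (countAbove-∷-< k<y)) (s≤s ih)
  step (yes k<x) (no k≮y) = ⊥-elim (k≮y (<-≤-trans k<x (xs≤ys (s≤s z≤n))))
  step (no k≮x) (yes k<y) = subst₂ _≤_ (sym (countAbove-∷-≮ k≮x)) (sym (countAbove-∷-< k<y)) (m≤n⇒m≤1+n ih)
  step (no k≮x) (no k≮y) = subst₂ _≤_ (sym (countAbove-∷-≮ k≮x)) (sym (countAbove-∷-≮ k≮y)) ih

length-rowWord : ∀ T → length (rowWord T) ≡ ∑ (length (rows T)) (λ r → length (rowAt (rows T) r))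
length-rowWord (mkT la mu []) = refl
length-rowWord (mkT la mu (row ∷ rs)) =
  trans (length-++ (reverse row)) (cong₂ _+_ (length-reverse row) (length-rowWord (mkT la mu rs)))

All-from-! : ∀ {P : ℕ → Set} xs → (∀ {i} → i < length xs → P (xs ! i)) → All P xs
All-from-! [] _ = []
All-from-! (x ∷ xs) P! = P! (s≤s z≤n) ∷ All-from-! xs (P! ∘ s≤s)

module TransposedShape {d m la mu} (shape : IsSkewShape d m la mu) where
  open IsSkewShape shape

  la≤m : All (_≤ m) la
  la≤m = All-from-! la (λ i<|la| → la≤C _ (subst (_ <_) lenla i<|la|))

  mu≤m : All (_≤ m) mu
  mu≤m = All-from-! mu (λ i<|mu| → ≤-trans (mu⊆la _ (subst (_ <_) lenmu i<|mu|)) (la≤C _ (subst (_ <_) lenmu i<|mu|)))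

  P = tOuter d m la mu
  Q = tInner d m la mu

  length-rotPartition-conj : ∀ xs → length (rotPartition d (conj m xs)) ≡ m
  length-rotPartition-conj xs = trans (length-rotPartition d (conj m xs)) (length-conj m xs)

  |Q|≡|P| : length Q ≡ length P
  |Q|≡|P| = trans (length-rotPartition-conj la) (sym (length-rotPartition-conj mu))

  !-rotPartition-conj : ∀ xs {j} → j < m → rotPartition d (conj m xs) ! j ≡ d ∸ countAbove (m ∸ suc j) xs
  !-rotPartition-conj xs {j} j<m = begin
    rotPartition d (conj m xs) ! j               ≡⟨ !-rotPartition d (conj m xs) (subst (j <_) (sym (length-conj m xs)) j<m) ⟩
    d ∸ conj m xs ! (length (conj m xs) ∸ suc j) ≡⟨ cong (λ n → d ∸ conj m xs ! (n ∸ suc j)) (length-conj m xs) ⟩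
    d ∸ conj m xs ! (m ∸ suc j)                  ≡⟨ cong (d ∸_) (conj-! m xs (∸-suc-< j<m)) ⟩
    d ∸ countAbove (m ∸ suc j) xs                ∎

  rotPartition-conj≤d : ∀ xs {j} → j < length (rotPartition d (conj m xs)) → rotPartition d (conj m xs) ! j ≤ d
  rotPartition-conj≤d xs {j} j<n = subst (_≤ d)
    (sym (!-rotPartition-conj xs (subst (j <_) (length-rotPartition-conj xs) j<n))) (m∸n≤m d (countAbove (m ∸ suc j) xs))

  P≤d : ∀ {j} → j < length P → P ! j ≤ d
  P≤d = rotPartition-conj≤d mu

  Q≤d : ∀ {j} → j < length P → Q ! j ≤ d
  Q≤d j<|P| = rotPartition-conj≤d la (subst (_ <_) (sym |Q|≡|P|) j<|P|)

  tOuter-rot : tOuter d m (rotPartition m mu) (rotPartition m la) ≡ rotPartition d Q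
  tOuter-rot = cong (rotPartition d) (conj-rotPartition d m la lenla la≤m)

  tInner-rot : tInner d m (rotPartition m mu) (rotPartition m la) ≡ rotPartition d P
  tInner-rot = cong (rotPartition d) (conj-rotPartition d m mu lenmu mu≤m)

  -- Both sides are ∑ λ − ∑ μ, using ∑ λ = ∑_k #{r | λ_r > k} on the right.
  size-transpose : ∑ d (λ r → la ! r ∸ mu ! r) ≡ length (colCells d P Q)
  size-transpose = +-cancelʳ-≡ (∑ d (mu !_)) _ _ (begin
    ∑ d (λ r → la ! r ∸ mu ! r) + ∑ d (mu !_)
      ≡⟨ ∑-∸ d (la !_) (mu !_) (mu⊆la _) ⟩
    ∑ d (la !_)
      ≡⟨ trans (∑-countAbove m la la≤m) (cong (λ n → ∑ n (la !_)) lenla) ⟨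
    ∑ m (λ k → countAbove k la)
      ≡⟨ ∑-∸ m (λ k → countAbove k la) (λ k → countAbove k mu) (λ _ → countAbove-mono _ mu la (trans lenmu (sym lenla))
           (λ i<|mu| → mu⊆la _ (subst (_ <_) lenmu i<|mu|))) ⟨
    ∑ m (λ k → countAbove k la ∸ countAbove k mu) + ∑ m (λ k → countAbove k mu)
      ≡⟨ cong₂ _+_ columns (trans (∑-countAbove m mu mu≤m) (cong (λ n → ∑ n (mu !_)) lenmu)) ⟩
    length (colCells d P Q) + ∑ d (mu !_) ∎)
    where
    columns : ∑ m (λ k → countAbove k la ∸ countAbove k mu) ≡ length (colCells d P Q)
    columns = begin
      ∑ m (λ k → countAbove k la ∸ countAbove k mu)
        ≡⟨ ∑-reverse m (λ k → countAbove k la ∸ countAbove k mu) ⟨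
      ∑ m (λ j → countAbove (m ∸ suc j) la ∸ countAbove (m ∸ suc j) mu)
        ≡⟨ ∑-cong m (λ j<m → sym (trans (cong₂ _∸_ (!-rotPartition-conj mu j<m) (!-rotPartition-conj la j<m))
             ([m∸o]∸[m∸n]≡n∸o (countAbove≤d la lenla) (countAbove≤d mu lenmu)))) ⟩
      ∑ m (λ j → P ! j ∸ Q ! j)
        ≡⟨ cong (λ n → ∑ n (λ j → P ! j ∸ Q ! j)) (length-rotPartition-conj mu) ⟨
      ∑ (length P) (λ j → P ! j ∸ Q ! j)
        ≡⟨ length-colCells d P Q P≤d ⟨
      length (colCells d P Q) ∎
      where
      countAbove≤d : ∀ {k} xs → length xs ≡ d → countAbove k xs ≤ d
      countAbove≤d {k} xs |xs|≡d = subst (countAbove k xs ≤_) |xs|≡d (countAbove≤length k xs)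

All-from-rowAt : ∀ {P : List ℕ → Set} rs → (∀ {i} → i < length rs → P (rowAt rs i)) → All P rs
All-from-rowAt [] _ = []
All-from-rowAt (row ∷ rs) P! = P! (s≤s z≤n) ∷ All-from-rowAt rs (P! ∘ s≤s)

All-reverse : ∀ {P : ℕ → Set} xs → All P xs → All P (reverse xs)
All-reverse xs all = All.tabulate (λ x∈rxs → All.lookup all (Any.reverse⁻ x∈rxs))

length-otYWord : ∀ w → length (otYWord w) ≡ length w
length-otYWord w = trans (cong length (otYWord≡labelOccurrences w)) (length-labelOccurrences otYLabel [] w)

length-otOppWord : ∀ d w → length (otOppWord d w) ≡ length w
length-otOppWord d w = trans (cong length (otOppWord≡labelOccurrences d w)) (length-labelOccurrences (otOppLabel d w) [] w)

transposeFill : ℕ → ℕ → SkewTableau → List ℕ → SkewTableau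
transposeFill d m T u = mkT la′ mu′ (fillByColWord d la′ mu′ u)
  where
  la′ = tOuter d m (outer T) (inner T)
  mu′ = tInner d m (outer T) (inner T)

module _ {d m K T} (tab : IsTableau d m K T) where
  open IsTableau tab
  open IsSkewShape shape

  rowWord-letters : All (InAlphabet K) (rowWord T)
  rowWord-letters = All.concat⁺ (All.map⁺ (All.map (λ {row} → All-reverse row)
    (All-from-rowAt (rows T) (λ r<|rs| → row-letters (subst (_ <_) lenRows r<|rs|)))))
    where
    row-letters : ∀ {r} → r < d → All (InAlphabet K) (rowAt (rows T) r)
    row-letters {r} r<d = All-from-! (rowAt (rows T) r) λ {i} i<|row| →
      subst (InAlphabet K) (cong (rowAt (rows T) r !_) (m+n∸m≡n (inner T ! r) i))
        (letters r (inner T ! r + i) (m≤m+n (inner T ! r) i , in-row i<|row|))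
      where
      in-row : ∀ {i} → i < length (rowAt (rows T) r) → inner T ! r + i < outer T ! r
      in-row {i} i<|row| = subst (inner T ! r + i <_) (m+[n∸m]≡n (mu⊆la r r<d))
        (+-monoʳ-< (inner T ! r) (subst (i <_) (lenRow r r<d) i<|row|))

  length-rowWord-tableau : length (rowWord T) ≡ ∑ d (λ r → outer T ! r ∸ inner T ! r)
  length-rowWord-tableau = trans (length-rowWord T) (trans (cong (λ n → ∑ n (length ∘ rowAt (rows T))) lenRows) (∑-cong d (lenRow _)))

  transposeFill-rot : ∀ L v → length v ≡ length (rowWord T) →
    transposeFill d m (rot m d T) (rotWord L v) ≡ rot d L (transposeFill d m T v)
  transposeFill-rot L v |v|≡|w| = begin
    transposeFill d m (rot m d T) (rotWord L v)
      ≡⟨ cong₂ (λ la′ mu′ → mkT la′ mu′ (fillByColWord d la′ mu′ (rotWord L v))) tOuter-rot tInner-rot ⟩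
    mkT (rotPartition d Q) (rotPartition d P) (fillByColWord d (rotPartition d Q) (rotPartition d P) (rotWord L v))
      ≡⟨ cong (mkT (rotPartition d Q) (rotPartition d P)) (fillByColWord-rot (rotLetter L) v |v|≡N) ⟩
    rot d L (transposeFill d m T v) ∎
    where
    open TransposedShape shape
    open RotatedShape d P Q |Q|≡|P| P≤d Q≤d using (fillByColWord-rot)
    |v|≡N : length v ≡ length (colCells d P Q)
    |v|≡N = trans |v|≡|w| (trans length-rowWord-tableau size-transpose)

proposition4p5 : (n d : ℕ) → d ≤ n → (T : SkewTableau) →
    (IsLR d (n ∸ d) T →
      otOpp d (n ∸ d) (rot (n ∸ d) d T) ≡ rot d (nu1LR T) (otLR d (n ∸ d) T))
    × (IsOppLR d (n ∸ d) T →
      otLR d (n ∸ d) (rot (n ∸ d) d T) ≡ rot d (nu1Opp d T) (otOpp d (n ∸ d) T))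
proposition4p5 n d _ T = LR , OppLR
  where
  m = n ∸ d
  w = rowWord T

  LR : IsLR d m T → otOpp d m (rot m d T) ≡ rot d (nu1LR T) (otLR d m T)
  LR (tab , Y) = begin
    transposeFill d m (rot m d T) (otOppWord d (rowWord (rot m d T)))
      ≡⟨ cong (transposeFill d m (rot m d T) ∘ otOppWord d) (rowWord-rot m d T) ⟩
    transposeFill d m (rot m d T) (otOppWord d (rotWord d w))
      ≡⟨ cong (transposeFill d m (rot m d T)) (otOppWord-rotWord d w (rowWord-letters tab) Y) ⟩
    transposeFill d m (rot m d T) (rotWord (count 1 w) (otYWord w))
      ≡⟨ transposeFill-rot tab (count 1 w) (otYWord w) (length-otYWord w) ⟩
    rot d (count 1 w) (transposeFill d m T (otYWord w)) ∎

  OppLR : IsOppLR d m T → otLR d m (rot m d T) ≡ rot d (nu1Opp d T) (otOpp d m T)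
  OppLR (tab , A) = begin
    transposeFill d m (rot m d T) (otYWord (rowWord (rot m d T)))
      ≡⟨ cong (transposeFill d m (rot m d T) ∘ otYWord) (rowWord-rot m d T) ⟩
    transposeFill d m (rot m d T) (otYWord (rotWord d w))
      ≡⟨ cong (transposeFill d m (rot m d T)) (otYWord-rotWord d w (rowWord-letters tab) A) ⟩
    transposeFill d m (rot m d T) (rotWord (count d w) (otOppWord d w))
      ≡⟨ transposeFill-rot tab (count d w) (otOppWord d w) (length-otOppWord d w) ⟩
    rot d (count d w) (transposeFill d m T (otOppWord d w)) ∎
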